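{- Let $m$ be a positive integer. (i) If $m\equiv 1\pmod 4$, then $2r_{(1,0)}(x^2+3y^2,m)=r_{(1,1)}(x^2+3y^2,4m)$. (ii) If $m\equiv 3\pmod 4$, then $2r_{(0,1)}(x^2+3y^2,m)=r_{(1,1)}(x^2+3y^2,4m)$. (iii) If $m\equiv 4\pmod 8$, then $2r_{(0,0)}(x^2+3y^2,m)=r_{(1,1)}(x^2+3y^2,m)$.
   Context: For a quadratic form $f$ in $k$ variables, an integer $n$ and $\mathbf d=(d_1,\dots,d_k)\in(\mathbb Z/2\mathbb Z)^k$, $r_{\mathbf d}(f,n)$ denotes the number of $(x_1,\dots,x_k)\in\mathbb Z^k$ with $f(x_1,\dots,x_k)=n$ and $(x_1,\dots,x_k)\equiv(d_1,\dots,d_k)\pmod 2$. -}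

module Defs where

open import Data.Nat as ℕ using (ℕ; zero; suc)
open import Data.Integer as ℤ using (ℤ; +_; -[1+_]; _+_; _*_; _-_)
open import Data.Integer.DivMod using (_%ℕ_)
open import Data.List using (List; []; _∷_; map; concatMap; filter; length; upTo)
open import Data.Product using (_×_; _,_)
open import Relation.Nullary.Decidable using (_×-dec_)
import Data.Nat.Properties as ℕP
import Data.Integer.Properties as ℤP

Q : ℤ → ℤ → ℤ
Q x y = x * x + + 3 * (y * y)

parity : ℤ → ℕ
parity z = z %ℕ 2

range : ℕ → List ℤ
range N = map (λ i → + i - + N) (upTo (suc (N ℕ.+ N)))

box : ℕ → List (ℤ × ℤ)
box N = concatMap (λ x → map (λ y → (x , y)) (range N)) (range N)

-- Every solution lies in the
-- finite box [-n,n]² (x² ≤ n and y² ≤ n), so counting there is exact.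
r : ℕ × ℕ → ℕ → ℕ
r (d₁ , d₂) n =
  length (filter (λ p → let x = Data.Product.proj₁ p ; y = Data.Product.proj₂ p in
                   (Q x y ℤ.≟ + n) ×-dec ((parity x ℕ.≟ d₁) ×-dec (parity y ℕ.≟ d₂)))
                 (box n))

module Submission where

-- Q(x, y) = x² + 3y² is the norm of x + y√−3, and 1 ± √−3 have norm 4. Multiplying by them (after
-- conjugating, in one case) gives φ(x, y) = (x + 3y, x − y) and ψ(x, y) = (x + 3y, y − x), which multiply Q
-- by 4. For odd n every solution of Q = n has x − y odd (Q ≡ (x − y)² mod 2), so φ and ψ send the solutions
-- of n injectively to odd–odd solutions of 4n. Images under φ have 4 ∣ X − Y and images under ψ have
-- 4 ∣ X + Y; for odd X, Y exactly one of the two holds, so the images partition the odd–odd solutions of 4n,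
-- and r₁₁(4n) = 2·#{Q = n}. As odd squares are 1 mod 4, Q(x, y) ≡ (x mod 2) + 3·(y mod 2) (mod 4): for
-- n ≡ 1 (resp. 3) mod 4 all solutions of n have parity (1, 0) (resp. (0, 1)). Finally, for m = 4n the
-- even–even solutions of m are the doubles of the solutions of n.

open import Level using (0ℓ)
open import Function using (_∘_; _⇔_; mk⇔)
open import Data.Nat as ℕ using (ℕ; zero; suc; s≤s; z≤n)
import Data.Nat.Properties as ℕₚ
open import Data.Integer using (ℤ; +_; -[1+_]; ∣_∣)
import Data.Integer.Properties as ℤₚ
open import Data.Product using (_×_; _,_; proj₁; proj₂; map₂; uncurry; ∃-syntax)
open import Data.Sum using (_⊎_; inj₁; inj₂)
open import Data.List using (List; []; _∷_; map; filter; length; _++_; concatMap; cartesianProduct)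
open import Data.List.Properties using (length-++; length-map)
open import Data.List.Membership.Propositional using (_∈_)
open import Data.List.Membership.Propositional.Properties
  using (∈-map⁺; ∈-map⁻; ∈-++⁺ˡ; ∈-++⁺ʳ; ∈-++⁻; ∈-filter⁺; ∈-filter⁻; ∈-upTo⁺; ∈-cartesianProduct⁺)
open import Data.List.Membership.Propositional.Properties.WithK using (unique∧set⇒bag)
open import Data.List.Relation.Unary.Unique.Propositional using (Unique)
import Data.List.Relation.Unary.Unique.Propositional.Properties as Unique
open import Data.List.Relation.Binary.BagAndSetEquality using (∼bag⇒↭)
open import Data.List.Relation.Binary.Permutation.Propositional.Properties using (↭-length)
open import Relation.Nullary.Decidable using (_×-dec_)
open import Relation.Unary using (Pred; Decidable; _⊆_; _≐_; _∪_; _∩_; Empty)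
open import Data.Empty using (⊥; ⊥-elim)
open import Relation.Binary.PropositionalEquality
open import Defs

record _HasSize_ {A : Set} (P : Pred A 0ℓ) (k : ℕ) : Set where
  constructor enumeration
  field
    elements : List A
    unique   : Unique elements
    sound    : ∀ {z} → z ∈ elements → P z
    complete : ∀ {z} → P z → z ∈ elements
    length≡  : length elements ≡ k

open _HasSize_

Image : {A B : Set} → (A → B) → Pred A 0ℓ → Pred B 0ℓ
Image f P z = ∃[ u ] P u × f u ≡ z

module _ {A : Set} {P : Pred A 0ℓ} where

  size-unique : ∀ {a b} → P HasSize a → P HasSize b → a ≡ b
  size-unique S T = begin
    _                     ≡⟨ sym (length≡ S) ⟩
    length (elements S)   ≡⟨ ↭-length (∼bag⇒↭ (unique∧set⇒bag (unique S) (unique T) same-elements)) ⟩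
    length (elements T)   ≡⟨ length≡ T ⟩
    _                     ∎
    where
    open ≡-Reasoning
    same-elements : ∀ {z} → z ∈ elements S ⇔ z ∈ elements T
    same-elements = mk⇔ (complete T ∘ sound S) (complete S ∘ sound T)

  size-resp : ∀ {R : Pred A 0ℓ} {k} → P ≐ R → P HasSize k → R HasSize k
  size-resp (P⊆R , R⊆P) S = enumeration (elements S) (unique S) (P⊆R ∘ sound S) (complete S ∘ R⊆P) (length≡ S)

  size-∪ : ∀ {R : Pred A 0ℓ} {a b} → Empty (P ∩ R) → P HasSize a → R HasSize b → (P ∪ R) HasSize (a ℕ.+ b)
  size-∪ {R} {a} {b} disjoint S T = enumeration (elements S ++ elements T) unique′ sound′ complete′ length′
    where
    unique′ : Unique (elements S ++ elements T)
    unique′ = Unique.++⁺ (unique S) (unique T)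
      (λ (z∈S , z∈T) → disjoint _ (sound S z∈S , sound T z∈T))
    sound′ : ∀ {z} → z ∈ elements S ++ elements T → (P ∪ R) z
    sound′ z∈ with ∈-++⁻ (elements S) z∈
    ... | inj₁ z∈S = inj₁ (sound S z∈S)
    ... | inj₂ z∈T = inj₂ (sound T z∈T)
    complete′ : ∀ {z} → (P ∪ R) z → z ∈ elements S ++ elements T
    complete′ (inj₁ Pz) = ∈-++⁺ˡ (complete S Pz)
    complete′ (inj₂ Rz) = ∈-++⁺ʳ (elements S) (complete T Rz)
    length′ : length (elements S ++ elements T) ≡ a ℕ.+ b
    length′ = trans (length-++ (elements S)) (cong₂ ℕ._+_ (length≡ S) (length≡ T))

module _ {A B : Set} {P : Pred A 0ℓ} {f : A → B} where

  size-image : ∀ {k} → (∀ {u v} → f u ≡ f v → u ≡ v) → P HasSize k → Image f P HasSize k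
  size-image f-injective S =
    enumeration (map f (elements S)) (Unique.map⁺ f-injective (unique S)) sound′ complete′
                (trans (length-map f (elements S)) (length≡ S))
    where
    sound′ : ∀ {z} → z ∈ map f (elements S) → Image f P z
    sound′ z∈ with ∈-map⁻ f z∈
    ... | u , u∈S , refl = u , sound S u∈S , refl
    complete′ : ∀ {z} → Image f P z → z ∈ map f (elements S)
    complete′ (u , Pu , refl) = ∈-map⁺ f (complete S Pu)

filter-size : {A : Set} {P : Pred A 0ℓ} (P? : Decidable P) {xs : List A} →
              Unique xs → P ⊆ (_∈ xs) → P HasSize length (filter P? xs)
filter-size P? {xs} xs-unique P⊆xs =
  enumeration _ (Unique.filter⁺ P? xs-unique) (proj₂ ∘ ∈-filter⁻ P? {xs = xs})
              (λ Pz → ∈-filter⁺ P? (P⊆xs Pz) Pz) refl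

concatMap-pairs≡cartesianProduct : {A B : Set} (xs : List A) (ys : List B) →
                                   concatMap (λ x → map (x ,_) ys) xs ≡ cartesianProduct xs ys
concatMap-pairs≡cartesianProduct []       ys = refl
concatMap-pairs≡cartesianProduct (x ∷ xs) ys = cong (map (x ,_) ys ++_) (concatMap-pairs≡cartesianProduct xs ys)

m≤m*m : ∀ m → m ℕ.≤ m ℕ.* m
m≤m*m zero      = z≤n
m≤m*m m@(suc _) = ℕₚ.m≤m*n m m

m*d<d⇒m≡0 : ∀ {m d} → m ℕ.* d ℕ.< d → m ≡ 0
m*d<d⇒m≡0 {zero}      _    = refl
m*d<d⇒m≡0 {suc m} {d} m*d<d = ⊥-elim (ℕₚ.<⇒≱ m*d<d (ℕₚ.m≤m+n d (m ℕ.* d)))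

-- Integer operators are opened only in this module, so that the statement below uses those of ℕ.
module _ where

  open import Data.Integer using (_+_; _*_; _-_; -_; _⊖_; _/ℕ_; _%ℕ_; _≟_)
  open import Data.Integer.DivMod using (a≡a%ℕn+[a/ℕn]*n; n%ℕd<d)
  open import Data.Integer.Divisibility.Signed using (_∣_; divides)
  open import Data.Integer.Tactic.RingSolver using (solve; solve-∀)
  open import Algebra.Properties.AbelianGroup ℤₚ.+-0-abelianGroup using () renaming (∙-cancelʳ to +-cancelʳ)
  open ≡-Reasoning

  range-unique : ∀ N → Unique (range N)
  range-unique N = Unique.map⁺ (λ {i} {j} eq → ℤₚ.+-injective (+-cancelʳ (- + N) (+ i) (+ j) eq)) (Unique.upTo⁺ _)

  box-unique : ∀ N → Unique (box N)
  box-unique N = subst Unique (sym (concatMap-pairs≡cartesianProduct (range N) (range N)))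
                       (Unique.cartesianProduct⁺ (range-unique N) (range-unique N))

  range-∈ : ∀ N {i} → i ℕ.≤ N ℕ.+ N → + i - + N ∈ range N
  range-∈ N i≤2N = ∈-map⁺ _ (∈-upTo⁺ (s≤s i≤2N))

  ∈-range⁺ : ∀ {N} z → ∣ z ∣ ℕ.≤ N → z ∈ range N
  ∈-range⁺ {N} (+ k) k≤N = subst (_∈ range N) shift (range-∈ N (ℕₚ.+-monoˡ-≤ N k≤N))
    where
    shift : + (k ℕ.+ N) - + N ≡ + k
    shift = begin
      + (k ℕ.+ N) - + N  ≡⟨ ℤₚ.[+m]-[+n]≡m⊖n (k ℕ.+ N) N ⟩
      (k ℕ.+ N) ⊖ N      ≡⟨ ℤₚ.⊖-≥ (ℕₚ.m≤n+m N k) ⟩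
      + (k ℕ.+ N ℕ.∸ N)  ≡⟨ cong +_ (ℕₚ.m+n∸n≡m k N) ⟩
      + k                ∎
  ∈-range⁺ {N} -[1+ k ] k<N = subst (_∈ range N) shift (range-∈ N (ℕₚ.≤-trans (ℕₚ.m∸n≤m N (suc k)) (ℕₚ.m≤m+n N N)))
    where
    shift : + (N ℕ.∸ suc k) - + N ≡ -[1+ k ]
    shift = begin
      + (N ℕ.∸ suc k) - + N      ≡⟨ ℤₚ.[+m]-[+n]≡m⊖n (N ℕ.∸ suc k) N ⟩
      (N ℕ.∸ suc k) ⊖ N          ≡⟨ ℤₚ.⊖-≤ (ℕₚ.m∸n≤m N (suc k)) ⟩
      - + (N ℕ.∸ (N ℕ.∸ suc k))  ≡⟨ cong (-_ ∘ +_) (ℕₚ.m∸[m∸n]≡n k<N) ⟩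
      -[1+ k ]                   ∎

  ∈-box⁺ : ∀ {N x y} → ∣ x ∣ ℕ.≤ N → ∣ y ∣ ℕ.≤ N → (x , y) ∈ box N
  ∈-box⁺ {N} {x} {y} x≤N y≤N = subst ((x , y) ∈_) (sym (concatMap-pairs≡cartesianProduct (range N) (range N)))
                                      (∈-cartesianProduct⁺ (∈-range⁺ x x≤N) (∈-range⁺ y y≤N))

  square-abs : ∀ i → i * i ≡ + (∣ i ∣ ℕ.* ∣ i ∣)
  square-abs (+ k)    = sym (ℤₚ.pos-* k k)
  square-abs -[1+ k ] = refl

  solution-in-box : ∀ {n x y} → Q x y ≡ + n → (x , y) ∈ box n
  solution-in-box {n} {x} {y} Q≡n = ∈-box⁺ (ℕₚ.≤-trans (m≤m*m a) a²≤n) (ℕₚ.≤-trans (m≤m*m b) b²≤n)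
    where
    a b : ℕ
    a = ∣ x ∣
    b = ∣ y ∣
    n≡ : n ≡ a ℕ.* a ℕ.+ 3 ℕ.* (b ℕ.* b)
    n≡ = ℤₚ.+-injective (begin
      + n                                    ≡⟨ sym Q≡n ⟩
      x * x + + 3 * (y * y)                  ≡⟨ cong₂ (λ s t → s + + 3 * t) (square-abs x) (square-abs y) ⟩
      + (a ℕ.* a) + + 3 * + (b ℕ.* b)        ≡⟨ cong (_+_ (+ (a ℕ.* a))) (sym (ℤₚ.pos-* 3 (b ℕ.* b))) ⟩
      + (a ℕ.* a) + + (3 ℕ.* (b ℕ.* b))      ≡⟨ sym (ℤₚ.pos-+ (a ℕ.* a) (3 ℕ.* (b ℕ.* b))) ⟩
      + (a ℕ.* a ℕ.+ 3 ℕ.* (b ℕ.* b))        ∎)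
    a²≤n : a ℕ.* a ℕ.≤ n
    a²≤n = subst (a ℕ.* a ℕ.≤_) (sym n≡) (ℕₚ.m≤m+n (a ℕ.* a) (3 ℕ.* (b ℕ.* b)))
    b²≤n : b ℕ.* b ℕ.≤ n
    b²≤n = subst (b ℕ.* b ℕ.≤_) (sym n≡) (ℕₚ.≤-trans (ℕₚ.m≤n*m (b ℕ.* b) 3) (ℕₚ.m≤n+m (3 ℕ.* (b ℕ.* b)) (a ℕ.* a)))

  -- r − s is a multiple of d whose absolute value is below d.
  remainder-unique : ∀ {d r s} .{{_ : ℕ.NonZero d}} a b → r ℕ.< d → s ℕ.< d →
                     + r + a * + d ≡ + s + b * + d → r ≡ s
  remainder-unique {d} {r} {s} a b r<d s<d eq =
    ℤₚ.+-injective (ℤₚ.i-j≡0⇒i≡j (+ r) (+ s) (ℤₚ.∣i∣≡0⇒i≡0 ∣r-s∣≡0))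
    where
    rearrange : ∀ i j a b d → i + a * d ≡ j + b * d → i - j ≡ (b - a) * d
    rearrange i j a b d eq = begin
      i - j                      ≡⟨ solve (i ∷ j ∷ a ∷ d ∷ []) ⟩
      (i + a * d) - (j + a * d)  ≡⟨ cong (_- (j + a * d)) eq ⟩
      (j + b * d) - (j + a * d)  ≡⟨ solve (j ∷ a ∷ b ∷ d ∷ []) ⟩
      (b - a) * d                ∎
    ∣r-s∣≡ : ∣ + r - + s ∣ ≡ ∣ b - a ∣ ℕ.* d
    ∣r-s∣≡ = trans (cong ∣_∣ (rearrange (+ r) (+ s) a b (+ d) eq)) (ℤₚ.abs-* (b - a) (+ d))
    ∣r-s∣<d : ∣ + r - + s ∣ ℕ.< d
    ∣r-s∣<d = subst (ℕ._< d) (cong ∣_∣ (sym (ℤₚ.[+m]-[+n]≡m⊖n r s)))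
                    (ℕₚ.≤-<-trans (ℤₚ.∣m⊝n∣≤m⊔n r s) (ℕₚ.⊔-lub r<d s<d))
    ∣r-s∣≡0 : ∣ + r - + s ∣ ≡ 0
    ∣r-s∣≡0 = trans ∣r-s∣≡ (cong (ℕ._* d) (m*d<d⇒m≡0 {∣ b - a ∣} (subst (ℕ._< d) ∣r-s∣≡ ∣r-s∣<d)))

  [+r+k*d]%ℕd≡r : ∀ {d} .{{_ : ℕ.NonZero d}} r k → r ℕ.< d → (+ r + k * + d) %ℕ d ≡ r
  [+r+k*d]%ℕd≡r {d} r k r<d =
    remainder-unique ((+ r + k * + d) /ℕ d) k (n%ℕd<d (+ r + k * + d) d) r<d (sym (a≡a%ℕn+[a/ℕn]*n (+ r + k * + d) d))

  [i+k*d]%ℕd≡i%ℕd : ∀ {d} .{{_ : ℕ.NonZero d}} i k → (i + k * + d) %ℕ d ≡ i %ℕ d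
  [i+k*d]%ℕd≡i%ℕd {d} i k = begin
    (i + k * + d) %ℕ d                            ≡⟨ cong (λ j → (j + k * + d) %ℕ d) (a≡a%ℕn+[a/ℕn]*n i d) ⟩
    (+ (i %ℕ d) + i /ℕ d * + d + k * + d) %ℕ d    ≡⟨ cong (_%ℕ d) (ℤₚ.+-assoc (+ (i %ℕ d)) (i /ℕ d * + d) (k * + d)) ⟩
    (+ (i %ℕ d) + (i /ℕ d * + d + k * + d)) %ℕ d  ≡⟨ cong (λ j → (+ (i %ℕ d) + j) %ℕ d) (sym (ℤₚ.*-distribʳ-+ (+ d) (i /ℕ d) k)) ⟩
    (+ (i %ℕ d) + (i /ℕ d + k) * + d) %ℕ d        ≡⟨ [+r+k*d]%ℕd≡r (i %ℕ d) (i /ℕ d + k) (n%ℕd<d i d) ⟩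
    i %ℕ d                                        ∎

  parity<2 : ∀ z → parity z ℕ.< 2
  parity<2 z = n%ℕd<d z 2

  parity[k*2]≡0 : ∀ k → parity (k * + 2) ≡ 0
  parity[k*2]≡0 k = subst (λ j → parity j ≡ 0) (ℤₚ.+-identityˡ (k * + 2)) ([+r+k*d]%ℕd≡r 0 k (s≤s z≤n))

  parity-neg : ∀ z → parity (- z) ≡ parity z
  parity-neg z = begin
    parity (- z)                                           ≡⟨ cong (parity ∘ -_) (a≡a%ℕn+[a/ℕn]*n z 2) ⟩
    parity (- (+ parity z + z /ℕ 2 * + 2))                 ≡⟨ cong parity (neg-decomposition (+ parity z) (z /ℕ 2)) ⟩
    parity (+ parity z + (- (z /ℕ 2) - + parity z) * + 2)  ≡⟨ [+r+k*d]%ℕd≡r (parity z) (- (z /ℕ 2) - + parity z) (parity<2 z) ⟩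
    parity z                                               ∎
    where
    neg-decomposition : ∀ p w → - (p + w * + 2) ≡ p + (- w - p) * + 2
    neg-decomposition = solve-∀

  square-mod-4 : ∀ z → ∃[ k ] z * z ≡ + parity z + k * + 4
  square-mod-4 z = map₂ (trans (cong₂ _*_ z≡ z≡)) (decomposed (parity z) (parity<2 z))
    where
    w : ℤ
    w = z /ℕ 2
    z≡ : z ≡ + parity z + w * + 2
    z≡ = a≡a%ℕn+[a/ℕn]*n z 2
    even-square : ∀ w → (+ 0 + w * + 2) * (+ 0 + w * + 2) ≡ + 0 + w * w * + 4
    even-square = solve-∀
    odd-square : ∀ w → (+ 1 + w * + 2) * (+ 1 + w * + 2) ≡ + 1 + (w * w + w) * + 4
    odd-square = solve-∀
    decomposed : ∀ p → p ℕ.< 2 → ∃[ k ] (+ p + w * + 2) * (+ p + w * + 2) ≡ + p + k * + 4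
    decomposed 0 _ = w * w , even-square w
    decomposed 1 _ = w * w + w , odd-square w
    decomposed (suc (suc _)) (s≤s (s≤s ()))

  parity-square : ∀ z → parity (z * z) ≡ parity z
  parity-square z with square-mod-4 z
  ... | k , z²≡ = begin
    parity (z * z)                       ≡⟨ cong parity z²≡ ⟩
    parity (+ parity z + k * + 4)        ≡⟨ cong (λ j → parity (+ parity z + j)) (sym (ℤₚ.*-assoc k (+ 2) (+ 2))) ⟩
    parity (+ parity z + k * + 2 * + 2)  ≡⟨ [+r+k*d]%ℕd≡r (parity z) (k * + 2) (parity<2 z) ⟩
    parity z                             ∎

  Q-mod-4 : ∀ x y → ∃[ k ] Q x y ≡ + (parity x ℕ.+ 3 ℕ.* parity y) + k * + 4
  Q-mod-4 x y with square-mod-4 x | square-mod-4 y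
  ... | k , x²≡ | l , y²≡ = k + + 3 * l , (begin
    Q x y                                          ≡⟨ cong₂ (λ s t → s + + 3 * t) x²≡ y²≡ ⟩
    + px + k * + 4 + + 3 * (+ py + l * + 4)        ≡⟨ regroup (+ px) (+ py) k l ⟩
    + px + + 3 * + py + (k + + 3 * l) * + 4        ≡⟨ cong (_+ (k + + 3 * l) * + 4) residue ⟩
    + (px ℕ.+ 3 ℕ.* py) + (k + + 3 * l) * + 4      ∎)
    where
    px py : ℕ
    px = parity x
    py = parity y
    regroup : ∀ p q k l → p + k * + 4 + + 3 * (q + l * + 4) ≡ p + + 3 * q + (k + + 3 * l) * + 4
    regroup = solve-∀
    residue : + px + + 3 * + py ≡ + (px ℕ.+ 3 ℕ.* py)
    residue = trans (cong (_+_ (+ px)) (sym (ℤₚ.pos-* 3 py))) (sym (ℤₚ.pos-+ px (3 ℕ.* py)))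

  solution-mod-4 : ∀ {n x y} → Q x y ≡ + n → (parity x ℕ.+ 3 ℕ.* parity y) ℕ.% 4 ≡ n ℕ.% 4
  solution-mod-4 {n} {x} {y} Q≡n with Q-mod-4 x y
  ... | k , Q≡ = begin
    (parity x ℕ.+ 3 ℕ.* parity y) ℕ.% 4              ≡⟨ sym ([i+k*d]%ℕd≡i%ℕd (+ (parity x ℕ.+ 3 ℕ.* parity y)) k) ⟩
    (+ (parity x ℕ.+ 3 ℕ.* parity y) + k * + 4) %ℕ 4  ≡⟨ cong (_%ℕ 4) (trans (sym Q≡) Q≡n) ⟩
    n ℕ.% 4                                          ∎

  Q≡[x-y]²+2y[x+y] : ∀ x y → x * x + + 3 * (y * y) ≡ (x - y) * (x - y) + y * (x + y) * + 2
  Q≡[x-y]²+2y[x+y] = solve-∀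

  solution-parity : ∀ {n x y} → Q x y ≡ + n → parity (x - y) ≡ n ℕ.% 2
  solution-parity {n} {x} {y} Q≡n = begin
    parity (x - y)                                   ≡⟨ sym (parity-square (x - y)) ⟩
    parity ((x - y) * (x - y))                       ≡⟨ sym ([i+k*d]%ℕd≡i%ℕd ((x - y) * (x - y)) (y * (x + y))) ⟩
    parity ((x - y) * (x - y) + y * (x + y) * + 2)   ≡⟨ cong parity (sym (Q≡[x-y]²+2y[x+y] x y)) ⟩
    parity (Q x y)                                   ≡⟨ cong parity Q≡n ⟩
    n ℕ.% 2                                          ∎

  even-decomposition : ∀ {z} → parity z ≡ 0 → z ≡ z /ℕ 2 * + 2
  even-decomposition {z} z-even = begin
    z                          ≡⟨ a≡a%ℕn+[a/ℕn]*n z 2 ⟩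
    + parity z + z /ℕ 2 * + 2  ≡⟨ cong (λ p → + p + z /ℕ 2 * + 2) z-even ⟩
    + 0 + z /ℕ 2 * + 2         ≡⟨ ℤₚ.+-identityˡ (z /ℕ 2 * + 2) ⟩
    z /ℕ 2 * + 2               ∎

  odd-decomposition : ∀ {z} → parity z ≡ 1 → z ≡ + 1 + z /ℕ 2 * + 2
  odd-decomposition {z} z-odd = subst (λ p → z ≡ + p + z /ℕ 2 * + 2) z-odd (a≡a%ℕn+[a/ℕn]*n z 2)

  odd-odd-dichotomy : ∀ {X Y} → parity X ≡ 1 → parity Y ≡ 1 → (+ 4 ∣ X - Y) ⊎ (+ 4 ∣ X + Y)
  odd-odd-dichotomy {X} {Y} X-odd Y-odd
    with X /ℕ 2 | odd-decomposition {X} X-odd | Y /ℕ 2 | odd-decomposition {Y} Y-odd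
  ... | a | refl | b | refl
    with parity (a - b) | parity<2 (a - b) | (a - b) /ℕ 2 | a≡a%ℕn+[a/ℕn]*n (a - b) 2
  ... | 0 | _ | c | a-b≡ = inj₁ (divides c (begin
    (+ 1 + a * + 2) - (+ 1 + b * + 2)  ≡⟨ solve (a ∷ b ∷ []) ⟩
    (a - b) * + 2                      ≡⟨ cong (_* + 2) a-b≡ ⟩
    (+ 0 + c * + 2) * + 2              ≡⟨ solve (c ∷ []) ⟩
    c * + 4                            ∎))
  ... | 1 | _ | c | a-b≡ = inj₂ (divides (c + b + + 1) (begin
    (+ 1 + a * + 2) + (+ 1 + b * + 2)        ≡⟨ solve (a ∷ b ∷ []) ⟩
    (a - b) * + 2 + b * + 4 + + 2            ≡⟨ cong (λ t → t * + 2 + b * + 4 + + 2) a-b≡ ⟩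
    (+ 1 + c * + 2) * + 2 + b * + 4 + + 2    ≡⟨ solve (c ∷ b ∷ []) ⟩
    (c + b + + 1) * + 4                      ∎))
  ... | suc (suc _) | s≤s (s≤s ()) | _ | _

  odd-not-both : ∀ {X Y} → parity X ≡ 1 → + 4 ∣ X - Y → + 4 ∣ X + Y → ⊥
  odd-not-both {X} {Y} X-odd (divides a X-Y≡) (divides b X+Y≡) = 0≢1 (trans (sym X-even) X-odd)
    where
    0≢1 : 0 ≢ 1
    0≢1 ()
    X≡ : X ≡ (a + b) * + 2
    X≡ = ℤₚ.*-cancelʳ-≡ X ((a + b) * + 2) (+ 2) (begin
      X * + 2                ≡⟨ solve (X ∷ Y ∷ []) ⟩
      (X - Y) + (X + Y)      ≡⟨ cong₂ _+_ X-Y≡ X+Y≡ ⟩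
      a * + 4 + b * + 4      ≡⟨ solve (a ∷ b ∷ []) ⟩
      (a + b) * + 2 * + 2    ∎)
    X-even : parity X ≡ 0
    X-even = trans (cong parity X≡) (parity[k*2]≡0 (a + b))

  Solution : ℕ → Pred (ℤ × ℤ) 0ℓ
  Solution n (x , y) = Q x y ≡ + n

  SolutionOfParity : ℕ × ℕ → ℕ → Pred (ℤ × ℤ) 0ℓ
  SolutionOfParity (d₁ , d₂) n (x , y) = Q x y ≡ + n × (parity x ≡ d₁ × parity y ≡ d₂)

  r-size : ∀ d n → SolutionOfParity d n HasSize r d n
  r-size (d₁ , d₂) n = filter-size P? (box-unique n) (solution-in-box ∘ proj₁)
    where
    -- the decision procedure in the definition of r, so that the enumeration is the list r counts
    P? : Decidable (SolutionOfParity (d₁ , d₂) n)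
    P? (x , y) = (Q x y ≟ + n) ×-dec ((parity x ℕ.≟ d₁) ×-dec (parity y ℕ.≟ d₂))

  solutions-finite : ∀ n → ∃[ k ] Solution n HasSize k
  solutions-finite n = _ , filter-size (λ (x , y) → Q x y ≟ + n) (box-unique n) solution-in-box

  ×4-preserves : ∀ {n i j} → i ≡ + 4 * j → j ≡ + n → i ≡ + (4 ℕ.* n)
  ×4-preserves {n} i≡4j j≡n = trans i≡4j (trans (cong (+ 4 *_) j≡n) (sym (ℤₚ.pos-* 4 n)))

  ×4-reflects : ∀ {n i j} → i ≡ + 4 * j → i ≡ + (4 ℕ.* n) → j ≡ + n
  ×4-reflects {n} {i} {j} i≡4j i≡4n = ℤₚ.*-cancelˡ-≡ (+ 4) j (+ n) (trans (sym i≡4j) (trans i≡4n (ℤₚ.pos-* 4 n)))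

  φ : ℤ × ℤ → ℤ × ℤ
  φ (x , y) = x + + 3 * y , x - y

  conj : ℤ × ℤ → ℤ × ℤ
  conj (x , y) = x , - y

  ψ : ℤ × ℤ → ℤ × ℤ
  ψ = conj ∘ φ

  double : ℤ × ℤ → ℤ × ℤ
  double (x , y) = x * + 2 , y * + 2

  Q-φ : ∀ x y → (x + + 3 * y) * (x + + 3 * y) + + 3 * ((x - y) * (x - y)) ≡ + 4 * (x * x + + 3 * (y * y))
  Q-φ = solve-∀

  Q-conj : ∀ x y → x * x + + 3 * (- y * - y) ≡ x * x + + 3 * (y * y)
  Q-conj = solve-∀

  Q-double : ∀ x y → x * + 2 * (x * + 2) + + 3 * (y * + 2 * (y * + 2)) ≡ + 4 * (x * x + + 3 * (y * y))
  Q-double = solve-∀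

  φ-injective : ∀ {u v} → φ u ≡ φ v → u ≡ v
  φ-injective {x , y} {x′ , y′} φu≡φv = cong₂ _,_ x≡x′ y≡y′
    where
    4y≡ : ∀ x y → + 4 * y ≡ (x + + 3 * y) - (x - y)
    4y≡ = solve-∀
    x≡ : ∀ x y → x ≡ (x - y) + y
    x≡ = solve-∀
    y≡y′ : y ≡ y′
    y≡y′ = ℤₚ.*-cancelˡ-≡ (+ 4) y y′ (begin
      + 4 * y                    ≡⟨ 4y≡ x y ⟩
      (x + + 3 * y) - (x - y)    ≡⟨ cong₂ _-_ (cong proj₁ φu≡φv) (cong proj₂ φu≡φv) ⟩
      (x′ + + 3 * y′) - (x′ - y′) ≡⟨ sym (4y≡ x′ y′) ⟩
      + 4 * y′                   ∎)
    x≡x′ : x ≡ x′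
    x≡x′ = begin
      x              ≡⟨ x≡ x y ⟩
      (x - y) + y    ≡⟨ cong₂ _+_ (cong proj₂ φu≡φv) y≡y′ ⟩
      (x′ - y′) + y′ ≡⟨ sym (x≡ x′ y′) ⟩
      x′             ∎

  conj-involutive : ∀ v → conj (conj v) ≡ v
  conj-involutive (x , y) = cong (x ,_) (ℤₚ.neg-involutive y)

  ψ-injective : ∀ {u v} → ψ u ≡ ψ v → u ≡ v
  ψ-injective {u} {v} ψu≡ψv = φ-injective (begin
    φ u               ≡⟨ sym (conj-involutive (φ u)) ⟩
    conj (ψ u)        ≡⟨ cong conj ψu≡ψv ⟩
    conj (ψ v)        ≡⟨ conj-involutive (φ v) ⟩
    φ v               ∎)

  double-injective : ∀ {u v} → double u ≡ double v → u ≡ v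
  double-injective {x , y} {x′ , y′} eq =
    cong₂ _,_ (ℤₚ.*-cancelʳ-≡ x x′ (+ 2) (cong proj₁ eq)) (ℤₚ.*-cancelʳ-≡ y y′ (+ 2) (cong proj₂ eq))

  φ-odd-odd-solution : ∀ {n} → n ℕ.% 2 ≡ 1 → ∀ {u} → Solution n u → SolutionOfParity (1 , 1) (4 ℕ.* n) (φ u)
  φ-odd-odd-solution {n} n-odd {x , y} Q≡n = ×4-preserves (Q-φ x y) Q≡n , x+3y-odd , x-y-odd
    where
    x-y-odd : parity (x - y) ≡ 1
    x-y-odd = trans (solution-parity {x = x} {y = y} Q≡n) n-odd
    x+3y≡ : ∀ x y → x + + 3 * y ≡ x - y + y * + 2 * + 2
    x+3y≡ = solve-∀
    x+3y-odd : parity (x + + 3 * y) ≡ 1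
    x+3y-odd = begin
      parity (x + + 3 * y)              ≡⟨ cong parity (x+3y≡ x y) ⟩
      parity (x - y + y * + 2 * + 2)    ≡⟨ [i+k*d]%ℕd≡i%ℕd (x - y) (y * + 2) ⟩
      parity (x - y)                    ≡⟨ x-y-odd ⟩
      1                                 ∎

  conj-solution : ∀ {d n v} → SolutionOfParity d n v → SolutionOfParity d n (conj v)
  conj-solution {_ , _} {n} {x , y} (Q≡n , x-parity , y-parity) =
    trans (Q-conj x y) Q≡n , x-parity , trans (parity-neg y) y-parity

  φ-image : ∀ {n X Y} → + 4 ∣ X - Y → Q X Y ≡ + (4 ℕ.* n) → Image φ (Solution n) (X , Y)
  φ-image {n} {X} {Y} (divides c X-Y≡) Q≡4n =
    (c + Y , c) , ×4-reflects (Q-φ (c + Y) c) (trans (cong (uncurry Q) φu≡) Q≡4n) , φu≡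
    where
    φu≡ : φ (c + Y , c) ≡ (X , Y)
    φu≡ = cong₂ _,_ (begin
      c + Y + + 3 * c  ≡⟨ solve (c ∷ Y ∷ []) ⟩
      c * + 4 + Y      ≡⟨ cong (_+ Y) (sym X-Y≡) ⟩
      X - Y + Y        ≡⟨ solve (X ∷ Y ∷ []) ⟩
      X                ∎) (solve (c ∷ Y ∷ []))

  odd-odd-solution-image : ∀ {n} → SolutionOfParity (1 , 1) (4 ℕ.* n) ⊆ Image φ (Solution n) ∪ Image ψ (Solution n)
  odd-odd-solution-image {n} {X , Y} (Q≡4n , X-odd , Y-odd) with odd-odd-dichotomy {X} {Y} X-odd Y-odd
  ... | inj₁ 4∣X-Y = inj₁ (φ-image {X = X} {Y = Y} 4∣X-Y Q≡4n)
  ... | inj₂ 4∣X+Y with φ-image {X = X} {Y = - Y} (subst (+ 4 ∣_) (cong (_+_ X) (sym (ℤₚ.neg-involutive Y))) 4∣X+Y)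
                                (trans (Q-conj X Y) Q≡4n)
  ...   | u , Q≡n , φu≡ = inj₂ (u , Q≡n , trans (cong conj φu≡) (conj-involutive (X , Y)))

  φ-ψ-disjoint : ∀ {n} → n ℕ.% 2 ≡ 1 → Empty (Image φ (Solution n) ∩ Image ψ (Solution n))
  φ-ψ-disjoint n-odd _ (((x , y) , Q≡n , refl) , ((x′ , y′) , _ , ψu′≡φu)) =
    odd-not-both {x + + 3 * y} {x - y} (proj₁ (proj₂ (φ-odd-odd-solution n-odd {x , y} Q≡n))) (divides y (X-Y≡ x y)) (divides y′ X+Y≡)
    where
    X-Y≡ : ∀ x y → (x + + 3 * y) - (x - y) ≡ y * + 4
    X-Y≡ = solve-∀
    X+Y≡ : (x + + 3 * y) + (x - y) ≡ y′ * + 4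
    X+Y≡ = begin
      (x + + 3 * y) + (x - y)            ≡⟨ cong (uncurry _+_) (sym ψu′≡φu) ⟩
      (x′ + + 3 * y′) + - (x′ - y′)      ≡⟨ solve (x′ ∷ y′ ∷ []) ⟩
      y′ * + 4                           ∎

  odd-odd-size : ∀ {n k} → n ℕ.% 2 ≡ 1 → Solution n HasSize k →
                 SolutionOfParity (1 , 1) (4 ℕ.* n) HasSize (2 ℕ.* k)
  odd-odd-size {n} {k} n-odd S =
    subst (SolutionOfParity (1 , 1) (4 ℕ.* n) HasSize_) (cong (k ℕ.+_) (sym (ℕₚ.+-identityʳ k)))
      (size-resp (images-solutions , odd-odd-solution-image)
        (size-∪ (φ-ψ-disjoint n-odd) (size-image φ-injective S) (size-image ψ-injective S)))
    where
    images-solutions : Image φ (Solution n) ∪ Image ψ (Solution n) ⊆ SolutionOfParity (1 , 1) (4 ℕ.* n)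
    images-solutions (inj₁ (u , Q≡n , refl)) = φ-odd-odd-solution n-odd {u} Q≡n
    images-solutions (inj₂ (u , Q≡n , refl)) = conj-solution {v = φ u} (φ-odd-odd-solution n-odd {u} Q≡n)

  even-even-size : ∀ {n k} → Solution n HasSize k → SolutionOfParity (0 , 0) (4 ℕ.* n) HasSize k
  even-even-size {n} S = size-resp (doubles-solutions , halves) (size-image double-injective S)
    where
    doubles-solutions : Image double (Solution n) ⊆ SolutionOfParity (0 , 0) (4 ℕ.* n)
    doubles-solutions ((x , y) , Q≡n , refl) = ×4-preserves (Q-double x y) Q≡n , parity[k*2]≡0 x , parity[k*2]≡0 y
    halves : SolutionOfParity (0 , 0) (4 ℕ.* n) ⊆ Image double (Solution n)
    halves {X , Y} (Q≡4n , X-even , Y-even) =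
      (X /ℕ 2 , Y /ℕ 2) , ×4-reflects (Q-double (X /ℕ 2) (Y /ℕ 2)) (trans (cong (uncurry Q) doubled) Q≡4n) , doubled
      where
      doubled : double (X /ℕ 2 , Y /ℕ 2) ≡ (X , Y)
      doubled = cong₂ _,_ (sym (even-decomposition X-even)) (sym (even-decomposition Y-even))

  residue≡1 : ∀ {p q} → p ℕ.< 2 → q ℕ.< 2 → (p ℕ.+ 3 ℕ.* q) ℕ.% 4 ≡ 1 → p ≡ 1 × q ≡ 0
  residue≡1 {0} {0} _ _ ()
  residue≡1 {0} {1} _ _ ()
  residue≡1 {1} {0} _ _ _ = refl , refl
  residue≡1 {1} {1} _ _ ()
  residue≡1 {suc (suc _)} (s≤s (s≤s ())) _ _
  residue≡1 {_} {suc (suc _)} _ (s≤s (s≤s ())) _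

  residue≡3 : ∀ {p q} → p ℕ.< 2 → q ℕ.< 2 → (p ℕ.+ 3 ℕ.* q) ℕ.% 4 ≡ 3 → p ≡ 0 × q ≡ 1
  residue≡3 {0} {0} _ _ ()
  residue≡3 {0} {1} _ _ _ = refl , refl
  residue≡3 {1} {0} _ _ ()
  residue≡3 {1} {1} _ _ ()
  residue≡3 {suc (suc _)} (s≤s (s≤s ())) _ _
  residue≡3 {_} {suc (suc _)} _ (s≤s (s≤s ())) _

  solutions-of-parity : ∀ {d₁ d₂ n} →
                        (∀ {p q} → p ℕ.< 2 → q ℕ.< 2 → (p ℕ.+ 3 ℕ.* q) ℕ.% 4 ≡ n ℕ.% 4 → p ≡ d₁ × q ≡ d₂) →
                        SolutionOfParity (d₁ , d₂) n ≐ Solution n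
  solutions-of-parity {d₁} {d₂} {n} residue⇒parity = proj₁ , λ {u} → has-parity {u}
    where
    has-parity : Solution n ⊆ SolutionOfParity (d₁ , d₂) n
    has-parity {x , y} Q≡n = Q≡n , residue⇒parity (parity<2 x) (parity<2 y) (solution-mod-4 {x = x} {y = y} Q≡n)

  solutions-1-mod-4 : ∀ {n} → n ℕ.% 4 ≡ 1 → SolutionOfParity (1 , 0) n ≐ Solution n
  solutions-1-mod-4 n≡1 = solutions-of-parity (λ p<2 q<2 residue≡ → residue≡1 p<2 q<2 (trans residue≡ n≡1))

  solutions-3-mod-4 : ∀ {n} → n ℕ.% 4 ≡ 3 → SolutionOfParity (0 , 1) n ≐ Solution n
  solutions-3-mod-4 n≡3 = solutions-of-parity (λ p<2 q<2 residue≡ → residue≡3 p<2 q<2 (trans residue≡ n≡3))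

  r-from-size : ∀ d n {k} → SolutionOfParity d n HasSize k → r d n ≡ k
  r-from-size d n = size-unique (r-size d n)

open import Data.Nat using (ℕ; _*_; _%_; _≥_)
open import Data.Nat.DivMod using (m≡m%n+[m/n]*n; m∣n⇒o%n%m≡o%m; [m+kn]%n≡m%n)
open import Data.Nat.Divisibility using (divides)
open import Data.Nat.Tactic.RingSolver using (solve-∀)

mod-4⇒mod-2 : ∀ m {r} → m % 4 ≡ r → m % 2 ≡ r % 2
mod-4⇒mod-2 m refl = sym (m∣n⇒o%n%m≡o%m 2 4 m (divides 2 refl))

4-mod-8⇒4×odd : ∀ m → m % 8 ≡ 4 → ∃[ n ] m ≡ 4 * n × n % 2 ≡ 1
4-mod-8⇒4×odd m m≡4 = 1 ℕ.+ q * 2 , m≡4n , [m+kn]%n≡m%n 1 q 2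
  where
  q : ℕ
  q = m ℕ./ 8
  4+8q≡4[1+2q] : ∀ q → 4 ℕ.+ q * 8 ≡ 4 * (1 ℕ.+ q * 2)
  4+8q≡4[1+2q] = solve-∀
  m≡4n : m ≡ 4 * (1 ℕ.+ q * 2)
  m≡4n = trans (m≡m%n+[m/n]*n m 8) (trans (cong (ℕ._+ q * 8) m≡4) (4+8q≡4[1+2q] q))

lemma3p1 : (m : ℕ) → m ≥ 1 →
    (m % 4 ≡ 1 → 2 * r (1 , 0) m ≡ r (1 , 1) (4 * m))
    × (m % 4 ≡ 3 → 2 * r (0 , 1) m ≡ r (1 , 1) (4 * m))
    × (m % 8 ≡ 4 → 2 * r (0 , 0) m ≡ r (1 , 1) m)
lemma3p1 m _ = part-i , part-ii , part-iii
  where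
  part-i : m % 4 ≡ 1 → 2 * r (1 , 0) m ≡ r (1 , 1) (4 * m)
  part-i m≡1 = sym (r-from-size (1 , 1) (4 * m) (odd-odd-size (mod-4⇒mod-2 m m≡1) solutions))
    where
    solutions : Solution m HasSize r (1 , 0) m
    solutions = size-resp (solutions-1-mod-4 m≡1) (r-size (1 , 0) m)
  part-ii : m % 4 ≡ 3 → 2 * r (0 , 1) m ≡ r (1 , 1) (4 * m)
  part-ii m≡3 = sym (r-from-size (1 , 1) (4 * m) (odd-odd-size (mod-4⇒mod-2 m m≡3) solutions))
    where
    solutions : Solution m HasSize r (0 , 1) m
    solutions = size-resp (solutions-3-mod-4 m≡3) (r-size (0 , 1) m)
  part-iii : m % 8 ≡ 4 → 2 * r (0 , 0) m ≡ r (1 , 1) m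
  part-iii m≡4 with 4-mod-8⇒4×odd m m≡4
  ... | n , m≡4n , n-odd with solutions-finite n
  ...   | k , solutions = subst (λ m → 2 * r (0 , 0) m ≡ r (1 , 1) m) (sym m≡4n)
                            (trans (cong (2 *_) (r-from-size (0 , 0) (4 * n) (even-even-size solutions)))
                                   (sym (r-from-size (1 , 1) (4 * n) (odd-odd-size n-odd solutions))))
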